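{- Let $m\ge 1$, $n\ge 1$, and let $a_0,b_1,\dots,b_n$ be positive integers. Let $\mathfrak R$ be a radial part with root $v_0$, built from data $a_0,b_1,\dots,b_n$ and rooted graphs $(H_1,v_1),\dots,(H_n,v_n)$ in the class $\mathcal C$, all as described in the context. For $1\le i\le n$ let $$A_i=\frac{Z(H_i)}{Z(H_i-v_i)}.$$ When $H_i$ is a star with $A_i-1$ leaves, $A_i$ is a positive integer; in general $A_i$ is the value of the (branched) continued fraction describing $H_i$. Let $G$ be the $m$-fold radial graph obtained by taking $m$ disjoint copies of $\mathfrak R$ and identifying their roots $v_0$ into a single vertex. Then the Hosoya index of $G$ is the numerator of the convergent of the multidimensional continued fraction $$ m(a_0-1)+1+\underbrace{\cfrac{b_1}{A_1+\cfrac{b_2}{A_2+\ddots+\cfrac{b_n}{A_n}}}+\cdots+\cfrac{b_1}{A_1+\cfrac{b_2}{A_2+\ddots+\cfrac{b_n}{A_n}}}}_{m\ \text{summands}}, $$ computed without cancellation so that its denominator is $Z(\mathfrak R-v_0)^m$. Explicitly, $$ Z(G)=Z(\mathfrak R-v_0)^m\left(m(a_0-1)+1+m\cdot\cfrac{b_1}{A_1+\cfrac{b_2}{A_2+\ddots+\cfrac{b_n}{A_n}}}\right). $$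
   Context: Graphs may have parallel edges. The Hosoya index $Z(G)$ of a finite multigraph $G$ is the number of sets of pairwise vertex-disjoint edges of $G$, including the empty set, with parallel edges counted as distinct. For a vertex $v$, $G-v$ denotes $G$ with $v$ and its incident edges deleted. The class $\mathcal C$ of rooted multigraphs (branched caterpillar-bond graphs) is defined recursively. A rooted multigraph $(H,v)$ belongs to $\mathcal C$ if $H$ consists of: - the root $v$ with some number $k\ge 0$ of pendant vertices attached; - a path $v=w_0,w_1,\dots,w_t$ with $t\ge 0$, where $w_{j-1}$ and $w_j$ are joined by $d_j\ge 1$ parallel edges; - for each $j\ge 1$, a rooted graph $(H'_j,w_j)\in\mathcal C$ attached at $w_j$, sharing only the vertex $w_j$ with the rest of $H$. A star with $c-1$ leaves rooted at its center belongs to $\mathcal C$ (take $t=0$). A radial part $\mathfrak R$ with data $a_0,b_1,\dots,b_n$ and rooted graphs $(H_1,v_1),\dots,(H_n,v_n)$ in $\mathcal C$ is built as follows: - a root $v_0$ (the marked vertex) carrying $a_0-1$ pendant vertices; - a path $v_0,v_1,\dots,v_n$ in which $v_{i-1}$ and $v_i$ are joined by $b_i$ parallel edges; - for each $1\le i\le n$, the graph $H_i$ attached at $v_i$, meeting the rest of $\mathfrak R$ only in $v_i$. In the plain caterpillar-bond case each $H_i$ is a star with $A_i-1$ leaves centered at $v_i$. -}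

module Defs where

open import Data.Nat using (ℕ; zero; suc; _+_; _≤_)
open import Data.Fin using (Fin; zero; suc; _↑ˡ_; _↑ʳ_; _≟_)
open import Data.Product using (_×_; _,_)
open import Data.List using (List; []; _∷_; [_]; _++_; map; length; filter; replicate; mapMaybe; allFin)
open import Data.Maybe using (Maybe; just; nothing)
open import Data.List.Relation.Unary.AllPairs using (AllPairs; allPairs?)
open import Data.Vec using (Vec; []; _∷_)
open import Data.Vec.Relation.Unary.All using (All; []; _∷_)
open import Relation.Nullary using (¬_; Dec; yes; no)
open import Relation.Nullary.Decidable using (_×-dec_; ¬?)
open import Relation.Binary.PropositionalEquality using (_≡_; _≢_)
open import Data.Integer using (+_)
open import Data.Rational using (ℚ; 0ℚ; _÷_; ≢-nonZero)
import Data.Rational as ℚ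
import Data.Rational.Properties as ℚP

-- Finite multigraphs: vertex set Fin V, edges a list of (unordered)
-- endpoint pairs.  Parallel edges = repeated entries of the list;
-- they are distinct edges (distinct list positions).

record MultiGraph : Set where
  constructor mkGraph
  field
    V : ℕ
    E : List (Fin V × Fin V)
open MultiGraph public

sublists : {A : Set} → List A → List (List A)
sublists []       = [ [] ]
sublists (x ∷ xs) = sublists xs ++ map (x ∷_) (sublists xs)

Disjoint : {V : ℕ} → Fin V × Fin V → Fin V × Fin V → Set
Disjoint (u , v) (u' , v') = (u ≢ u') × (u ≢ v') × (v ≢ u') × (v ≢ v')

disjoint? : {V : ℕ} → (e f : Fin V × Fin V) → Dec (Disjoint e f)
disjoint? (u , v) (u' , v') =
  ¬? (u ≟ u') ×-dec ¬? (u ≟ v') ×-dec ¬? (v ≟ u') ×-dec ¬? (v ≟ v')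

IsMatching : {V : ℕ} → List (Fin V × Fin V) → Set
IsMatching = AllPairs Disjoint

Z : MultiGraph → ℕ
Z G = length (filter (allPairs? disjoint?) (sublists (E G)))

-- Rooted multigraphs: vertex set Fin (suc k), root = zero.

record Rooted : Set where
  constructor mkRooted
  field
    k  : ℕ
    RE : List (Fin (suc k) × Fin (suc k))
open Rooted public

underlying : Rooted → MultiGraph
underlying H = mkGraph (suc (k H)) (RE H)

dropRootEdge : {n : ℕ} → Fin (suc n) × Fin (suc n) → Maybe (Fin n × Fin n)
dropRootEdge (suc x , suc y) = just (x , y)
dropRootEdge _               = nothing

deleteRoot : Rooted → MultiGraph
deleteRoot H = mkGraph (k H) (mapMaybe dropRootEdge (RE H))

single : Rooted
single = mkRooted 0 []

star : ℕ → Rooted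
star p = mkRooted p (map (λ i → (zero , suc i)) (allFin p))

wedge : Rooted → Rooted → Rooted
wedge G H = mkRooted (k G + k H) (map emb₁ (RE G) ++ map emb₂ (RE H))
  where
  f₁ : Fin (suc (k G)) → Fin (suc (k G + k H))
  f₁ zero    = zero
  f₁ (suc i) = suc (i ↑ˡ k H)
  f₂ : Fin (suc (k H)) → Fin (suc (k G + k H))
  f₂ zero    = zero
  f₂ (suc j) = suc (k G ↑ʳ j)
  emb₁ : Fin (suc (k G)) × Fin (suc (k G)) → Fin (suc (k G + k H)) × Fin (suc (k G + k H))
  emb₁ (x , y) = (f₁ x , f₁ y)
  emb₂ : Fin (suc (k H)) × Fin (suc (k H)) → Fin (suc (k G + k H)) × Fin (suc (k G + k H))
  emb₂ (x , y) = (f₂ x , f₂ y)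

bond : ℕ → Rooted → Rooted
bond d H = mkRooted (suc (k H)) (replicate d (zero , suc zero) ++ map sh (RE H))
  where
  sh : Fin (suc (k H)) × Fin (suc (k H)) → Fin (suc (suc (k H))) × Fin (suc (suc (k H)))
  sh (x , y) = (suc x , suc y)

wedgePow : ℕ → Rooted → Rooted
wedgePow zero    R = single
wedgePow (suc m) R = wedge R (wedgePow m R)

-- The class C (branched caterpillar-bond graphs), as syntax trees.
-- node k c : root with k pendant vertices and the path described by c
--            starting at the root.
-- stop     : path ends here.
-- link d H c : next path vertex w_j, joined by d ≥ 1 parallel edges,
--              carrying the C-graph H attached at w_j, path continues c.

data CTree : Set
data Chain : Set

data CTree where
  node : ℕ → Chain → CTree

data Chain where
  stop : Chain
  link : (d : ℕ) → 1 ≤ d → CTree → Chain → Chain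

treeGraph  : CTree → Rooted
chainGraph : Chain → Rooted

treeGraph (node p c) = wedge (star p) (chainGraph c)

chainGraph stop             = single
chainGraph (link d _ H c)   = bond d (wedge (treeGraph H) (chainGraph c))

radialChain : {n : ℕ} → (bs : Vec ℕ n) → All (1 ≤_) bs → Vec CTree n → Chain
radialChain []       []         []       = stop
radialChain (b ∷ bs) (pb ∷ pbs) (H ∷ Hs) = link b pb H (radialChain bs pbs Hs)

radial : {n : ℕ} → (a₀ : ℕ) → (bs : Vec ℕ n) → All (1 ≤_) bs → Vec CTree n → Rooted
radial a₀ bs pbs Hs = treeGraph (node (a₀ Data.Nat.∸ 1) (radialChain bs pbs Hs))

ℕ→ℚ : ℕ → ℚ
ℕ→ℚ n = (+ n) ℚ./ 1

-- division, returning 0 for a zero divisor (never happens below: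
-- all divisors are positive)
_÷′_ : ℚ → ℚ → ℚ
p ÷′ q with q ℚP.≟ 0ℚ
... | yes _   = 0ℚ
... | no q≢0  = _÷_ p q {{≢-nonZero q≢0}}

ratioA : CTree → ℚ
ratioA H = ℕ→ℚ (Z (underlying (treeGraph H))) ÷′ ℕ→ℚ (Z (deleteRoot (treeGraph H)))

contFrac : {n : ℕ} → Vec ℕ n → Vec ℚ n → ℚ
contFrac []       []       = 0ℚ
contFrac (b ∷ bs) (A ∷ As) = ℕ→ℚ b ÷′ (A ℚ.+ contFrac bs As)

{-# OPTIONS --safe #-}
module Submission where

-- Write Z⁻ H = Z(H − v) and let the excess e(H) = (Z(H) − Z(H − v)) / Z(H − v) measure the
-- matchings that cover the root v. Gluing two rooted graphs at their roots multiplies Z⁻ and adds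
-- the excesses, because a matching of the wedge covers the common root from at most one side. A star
-- with p leaves has Z⁻ = 1 and excess p, and joining a new root to (H, v) by d parallel edges gives
-- Z⁻ = Z(H) and excess d / (1 + e(H)) = d / (Z(H) / Z(H − v)). Along the path of the radial part these
-- rules unfold into the continued fraction, and the m-fold wedge has Z⁻ = Z(R − v₀)^m and m times the
-- excess of R.

module Matchings where

  open import Defs
  open import Level using (Level)
  open import Data.Nat using (ℕ; zero; suc; _+_; _*_; _≤_)
  open import Data.Nat.Properties
    using (+-identityʳ; *-identityʳ; *-zeroʳ; *-distribˡ-+; +-assoc; +-comm; *-comm; ≤-refl; ≤-trans; m≤m+n)
  open import Data.Nat.Tactic.RingSolver using (solve-∀)
  open import Data.Bool using (Bool; true; false; _∨_; if_then_else_)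
  import Data.Bool.Properties as Bool
  open import Data.Fin using (Fin; zero; suc; _≟_; _↑ˡ_; _↑ʳ_; splitAt)
  open import Data.Fin.Properties using (suc-injective; ↑ˡ-injective; ↑ʳ-injective; splitAt-↑ˡ; splitAt-↑ʳ)
  open import Data.Vec.Functional using (Vector) renaming (_∷_ to _∷ᵛ_)
  open import Data.Product using (_×_; _,_; proj₁; proj₂)
  import Data.Product as Product
  open import Data.List
    using (List; []; _∷_; _++_; map; length; filter; replicate; mapMaybe; allFin)
  open import Data.List.Properties
    using (length-++; length-map; filter-++; filter-≐; filter-none; map-cong; length-tabulate)
  open import Data.List.Relation.Unary.All as All using (All; []; _∷_)
  open import Data.List.Relation.Unary.All.Properties using (map⁺; replicate⁺)
  open import Data.List.Relation.Unary.AllPairs using (allPairs?; _∷_)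
  open import Relation.Nullary using (¬_; does; yes; no; contradiction)
  open import Relation.Nullary.Decidable using (dec-true; dec-false; _×-dec_)
  open import Relation.Unary using (Pred; Decidable; _≐_)
  open import Relation.Binary.PropositionalEquality
  open import Function using (_∘_; id; Injective)
  open import Algebra.Bundles using (CommutativeMonoid)
  open import Algebra.Properties.CommutativeSemigroup
    (CommutativeMonoid.commutativeSemigroup Bool.∨-commutativeMonoid) using (xy∙z≈xz∙y)

  private variable
    n : ℕ

  VSet : ℕ → Set
  VSet = Vector Bool

  ∅ : VSet n
  ∅ _ = false

  Edge : ℕ → Set
  Edge n = Fin n × Fin n

  mapEdge : {m : ℕ} → (Fin m → Fin n) → Edge m → Edge n
  mapEdge f = Product.map f f

  infix 4 _≡ᵇ_
  _≡ᵇ_ : Fin n → Fin n → Bool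
  x ≡ᵇ y = does (x ≟ y)

  meets : VSet n → Edge n → Bool
  meets U (u , v) = U u ∨ U v

  addEnds : VSet n → Edge n → VSet n
  addEnds U (u , v) x = U x ∨ (u ≡ᵇ x) ∨ (v ≡ᵇ x)

  insert : Fin n → VSet n → VSet n
  insert r U x = U x ∨ (x ≡ᵇ r)

  -- sumMatchings es U k is the sum of k (U ∪ V(M)) over the matchings M ⊆ es avoiding U.
  sumMatchings : List (Edge n) → VSet n → (VSet n → ℕ) → ℕ
  sumMatchings []       U k = k U
  sumMatchings (e ∷ es) U k =
    sumMatchings es U k + (if meets U e then 0 else sumMatchings es (addEnds U e) k)

  nMatchings : List (Edge n) → VSet n → ℕ
  nMatchings es U = sumMatchings es U (λ _ → 1)

  ∨-≡false : {x y : Bool} → x ≡ false → y ≡ false → x ∨ y ≡ false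
  ∨-≡false refl refl = refl

  ∨-≡false⁻ : (x : Bool) {y : Bool} → x ∨ y ≡ false → x ≡ false × y ≡ false
  ∨-≡false⁻ false y≡false = refl , y≡false

  ≡ᵇ-refl : (x : Fin n) → (x ≡ᵇ x) ≡ true
  ≡ᵇ-refl x = dec-true (x ≟ x) refl

  ≢⇒≡ᵇ-false : {x y : Fin n} → x ≢ y → (x ≡ᵇ y) ≡ false
  ≢⇒≡ᵇ-false {x = x} {y} = dec-false (x ≟ y)

  ≡ᵇ-false⇒≢ : {x y : Fin n} → (x ≡ᵇ y) ≡ false → x ≢ y
  ≡ᵇ-false⇒≢ {x = x} {y} x≢ᵇy x≡y = contradiction (trans (sym (dec-true (x ≟ y) x≡y)) x≢ᵇy) λ ()

  ≡ᵇ-injective : {m : ℕ} {f : Fin m → Fin n} → Injective _≡_ _≡_ f →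
    ∀ x y → (f x ≡ᵇ f y) ≡ (x ≡ᵇ y)
  ≡ᵇ-injective {f = f} f-inj x y with x ≟ y
  ... | yes refl = ≡ᵇ-refl (f x)
  ... | no x≢y   = ≢⇒≡ᵇ-false (x≢y ∘ f-inj)

  AvoidingMatching : VSet n → List (Edge n) → Set
  AvoidingMatching U M = IsMatching M × All (λ f → meets U f ≡ false) M

  avoidingMatching? : (U : VSet n) → Decidable (AvoidingMatching U)
  avoidingMatching? U M = allPairs? disjoint? M ×-dec All.all? (λ f → meets U f Bool.≟ false) M

  avoids-addEnds : (U : VSet n) (e f : Edge n) →
    meets (addEnds U e) f ≡ false → Disjoint e f × meets U f ≡ false
  avoids-addEnds U (u , v) (u′ , v′) avoids =
    let avoids-u′ , avoids-v′ = ∨-≡false⁻ (U u′ ∨ (u ≡ᵇ u′) ∨ (v ≡ᵇ u′)) avoids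
        Uu′ , ends≢u′ = ∨-≡false⁻ (U u′) avoids-u′
        Uv′ , ends≢v′ = ∨-≡false⁻ (U v′) avoids-v′
        u≢u′ , v≢u′ = ∨-≡false⁻ (u ≡ᵇ u′) ends≢u′
        u≢v′ , v≢v′ = ∨-≡false⁻ (u ≡ᵇ v′) ends≢v′
    in (≡ᵇ-false⇒≢ u≢u′ , ≡ᵇ-false⇒≢ u≢v′ , ≡ᵇ-false⇒≢ v≢u′ , ≡ᵇ-false⇒≢ v≢v′)
       , ∨-≡false Uu′ Uv′

  avoids-addEnds⁻ : (U : VSet n) (e f : Edge n) →
    Disjoint e f → meets U f ≡ false → meets (addEnds U e) f ≡ false
  avoids-addEnds⁻ U (u , v) (u′ , v′) (u≢u′ , u≢v′ , v≢u′ , v≢v′) avoids =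
    let Uu′ , Uv′ = ∨-≡false⁻ (U u′) avoids
    in ∨-≡false (∨-≡false Uu′ (∨-≡false (≢⇒≡ᵇ-false u≢u′) (≢⇒≡ᵇ-false v≢u′)))
                (∨-≡false Uv′ (∨-≡false (≢⇒≡ᵇ-false u≢v′) (≢⇒≡ᵇ-false v≢v′)))

  avoidingMatching-∷ : (U : VSet n) (e : Edge n) → meets U e ≡ false →
    AvoidingMatching U ∘ (e ∷_) ≐ AvoidingMatching (addEnds U e)
  avoidingMatching-∷ U e e-avoids = shrink , grow
    where
    shrink : ∀ {M} → AvoidingMatching U (e ∷ M) → AvoidingMatching (addEnds U e) M
    shrink (disjoint ∷ matching , _ ∷ avoids) =
      matching , All.zipWith (λ (d , a) → avoids-addEnds⁻ U e _ d a) (disjoint , avoids)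
    grow : ∀ {M} → AvoidingMatching (addEnds U e) M → AvoidingMatching U (e ∷ M)
    grow (matching , avoids) =
      let disjoint , avoids′ = All.unzipWith (avoids-addEnds U e _) avoids
      in disjoint ∷ matching , e-avoids ∷ avoids′

  avoidingMatching-∷-blocked : (U : VSet n) (e : Edge n) → meets U e ≡ true →
    ∀ M → ¬ AvoidingMatching U (e ∷ M)
  avoidingMatching-∷-blocked U e e-meets _ (_ , e-avoids ∷ _) = contradiction (trans (sym e-meets) e-avoids) λ ()

  filter-map : {ℓ : Level} {A B : Set} {P : Pred B ℓ} (P? : Decidable P) (f : A → B) (xs : List A) →
    filter P? (map f xs) ≡ map f (filter (P? ∘ f) xs)
  filter-map P? f []       = refl
  filter-map P? f (x ∷ xs) with does (P? (f x))
  ... | true  = cong (f x ∷_) (filter-map P? f xs)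
  ... | false = filter-map P? f xs

  length-avoidingMatchings : (es : List (Edge n)) (U : VSet n) →
    length (filter (avoidingMatching? U) (sublists es)) ≡ nMatchings es U
  length-avoidingMatchings []       U = refl
  length-avoidingMatchings (e ∷ es) U = begin
    length (filter P? (sublists es ++ map extend (sublists es)))
      ≡⟨ cong length (filter-++ P? (sublists es) _) ⟩
    length (filter P? (sublists es) ++ filter P? (map extend (sublists es)))
      ≡⟨ length-++ (filter P? (sublists es)) ⟩
    length (filter P? (sublists es)) + length (filter P? (map extend (sublists es)))
      ≡⟨ cong₂ _+_ (length-avoidingMatchings es U)
                   (trans (cong length (filter-map P? extend (sublists es)))
                          (length-map extend (filter (P? ∘ extend) (sublists es)))) ⟩
    nMatchings es U + length (filter (P? ∘ extend) (sublists es))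
      ≡⟨ cong (nMatchings es U +_) (count (meets U e) refl) ⟩
    nMatchings (e ∷ es) U ∎
    where
    open ≡-Reasoning
    P? = avoidingMatching? U
    extend : List (Edge _) → List (Edge _)
    extend = e ∷_
    count : ∀ b → meets U e ≡ b →
      length (filter (P? ∘ extend) (sublists es)) ≡ (if b then 0 else nMatchings es (addEnds U e))
    count true  e-meets  = cong length
      (filter-none (P? ∘ extend) (All.universal (avoidingMatching-∷-blocked U e e-meets) (sublists es)))
    count false e-avoids = trans
      (cong length (filter-≐ (P? ∘ extend) (avoidingMatching? (addEnds U e))
                             (avoidingMatching-∷ U e e-avoids) (sublists es)))
      (length-avoidingMatchings es (addEnds U e))

  Z≡nMatchings : (G : MultiGraph) → Z G ≡ nMatchings (E G) ∅
  Z≡nMatchings G = trans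
    (cong length (filter-≐ (allPairs? disjoint?) (avoidingMatching? ∅)
                           (matching⇒avoiding , proj₁)
                           (sublists (E G))))
    (length-avoidingMatchings (E G) ∅)
    where
    matching⇒avoiding : ∀ {M} → IsMatching M → AvoidingMatching ∅ M
    matching⇒avoiding {M} matching = matching , All.universal (λ _ → refl) M

  sumMatchings-++ : (es fs : List (Edge n)) (U : VSet n) (k : VSet n → ℕ) →
    sumMatchings (es ++ fs) U k ≡ sumMatchings es U (λ W → sumMatchings fs W k)
  sumMatchings-++ []       fs U k = refl
  sumMatchings-++ (e ∷ es) fs U k =
    cong₂ _+_ (sumMatchings-++ es fs U k)
              (cong (if meets U e then 0 else_) (sumMatchings-++ es fs (addEnds U e) k))

  sumMatchings-meeting : (es : List (Edge n)) {U : VSet n} (k : VSet n → ℕ) →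
    All (λ e → meets U e ≡ true) es → sumMatchings es U k ≡ k U
  sumMatchings-meeting []       k []                = refl
  sumMatchings-meeting (e ∷ es) k (e-meets ∷ meet) rewrite e-meets =
    trans (+-identityʳ _) (sumMatchings-meeting es k meet)

  meets-addEnds : (U : VSet n) (e : Edge n) → meets (addEnds U e) e ≡ true
  meets-addEnds U (u , v) rewrite ≡ᵇ-refl u =
    cong (_∨ (U v ∨ (u ≡ᵇ v) ∨ (v ≡ᵇ v))) (Bool.∨-zeroʳ (U u))

  sumMatchings-parallel : (d : ℕ) (e : Edge n) {U : VSet n} (k : VSet n → ℕ) → meets U e ≡ false →
    sumMatchings (replicate d e) U k ≡ k U + d * k (addEnds U e)
  sumMatchings-parallel zero    e     k e-avoids = sym (+-identityʳ _)
  sumMatchings-parallel (suc d) e {U} k e-avoids rewrite e-avoids = begin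
    sumMatchings (replicate d e) U k + sumMatchings (replicate d e) (addEnds U e) k
      ≡⟨ cong₂ _+_ (sumMatchings-parallel d e k e-avoids)
                   (sumMatchings-meeting (replicate d e) k (replicate⁺ d (meets-addEnds U e))) ⟩
    k U + d * k (addEnds U e) + k (addEnds U e)
      ≡⟨ +-assoc (k U) _ _ ⟩
    k U + (d * k (addEnds U e) + k (addEnds U e))
      ≡⟨ cong (k U +_) (+-comm (d * k (addEnds U e)) _) ⟩
    k U + suc d * k (addEnds U e) ∎
    where open ≡-Reasoning

  nMatchings-cong : (es : List (Edge n)) {U U′ : VSet n} → U ≗ U′ → nMatchings es U ≡ nMatchings es U′
  nMatchings-cong []             U≗U′ = refl
  nMatchings-cong ((u , v) ∷ es) U≗U′ =
    cong₂ _+_ (nMatchings-cong es U≗U′)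
      (cong₂ (λ b m → if b then 0 else m) (cong₂ _∨_ (U≗U′ u) (U≗U′ v))
             (nMatchings-cong es (λ x → cong (_∨ _) (U≗U′ x))))

  nMatchings-positive : (es : List (Edge n)) (U : VSet n) → 1 ≤ nMatchings es U
  nMatchings-positive []       U = ≤-refl
  nMatchings-positive (e ∷ es) U = ≤-trans (nMatchings-positive es U) (m≤m+n _ _)

  nMatchings-map : {m : ℕ} {f : Fin m → Fin n} → Injective _≡_ _≡_ f →
    (es : List (Edge m)) (U : VSet n) → nMatchings (map (mapEdge f) es) U ≡ nMatchings es (U ∘ f)
  nMatchings-map         f-inj []             U = refl
  nMatchings-map {f = f} f-inj ((u , v) ∷ es) U =
    cong₂ _+_ (nMatchings-map f-inj es U)
      (cong (if U (f u) ∨ U (f v) then 0 else_)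
            (trans (nMatchings-map f-inj es _) (nMatchings-cong es addEnds-f)))
    where
    addEnds-f : addEnds U (f u , f v) ∘ f ≗ addEnds (U ∘ f) (u , v)
    addEnds-f x = cong₂ (λ a b → U (f x) ∨ a ∨ b) (≡ᵇ-injective f-inj u x) (≡ᵇ-injective f-inj v x)

  nMatchings-deleteRoot : (es : List (Edge (suc n))) (U : VSet n) →
    nMatchings (mapMaybe dropRootEdge es) U ≡ nMatchings es (true ∷ᵛ U)
  nMatchings-deleteRoot []                   U = refl
  nMatchings-deleteRoot ((zero  , _)     ∷ es) U = trans (nMatchings-deleteRoot es U) (sym (+-identityʳ _))
  nMatchings-deleteRoot ((suc x , zero)  ∷ es) U rewrite Bool.∨-zeroʳ (U x) =
    trans (nMatchings-deleteRoot es U) (sym (+-identityʳ _))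
  nMatchings-deleteRoot ((suc x , suc y) ∷ es) U =
    cong₂ _+_ (nMatchings-deleteRoot es U)
      (cong (if U x ∨ U y then 0 else_)
            (trans (nMatchings-deleteRoot es _) (nMatchings-cong es λ { zero → refl ; (suc _) → refl })))

  meets-insert : (r : Fin n) (U : VSet n) (e : Edge n) → meets U e ≡ true → meets (insert r U) e ≡ true
  meets-insert r U (u , v) e-meets with U u | U v
  ... | true  | _    = refl
  ... | false | true = Bool.∨-zeroʳ _

  addEnds-at-root : (r : Fin n) (U : VSet n) (e : Edge n) → meets U e ≡ false →
    addEnds U e r ≡ U r ∨ meets (insert r U) e
  addEnds-at-root r U (u , v) e-avoids
    rewrite proj₁ (∨-≡false⁻ (U u) e-avoids) | proj₂ (∨-≡false⁻ (U u) e-avoids) = refl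

  insert-addEnds : (r : Fin n) (U : VSet n) (e : Edge n) → insert r (addEnds U e) ≗ addEnds (insert r U) e
  insert-addEnds r U (u , v) x = xy∙z≈xz∙y (U x) ((u ≡ᵇ x) ∨ (v ≡ᵇ x)) (x ≡ᵇ r)

  module ByRoot (r : Fin n) (Good : VSet n → Set) (k : VSet n → ℕ) (c : Bool → ℕ)
                (k-good : ∀ {U} → Good U → k U ≡ c (U r)) where

    Preserves : Edge n → Set
    Preserves e = ∀ {U} → Good U → Good (addEnds U e)

    sumMatchings-covered : (es : List (Edge n)) → All Preserves es → ∀ {U} → Good U → U r ≡ true →
      sumMatchings es U k ≡ c true * nMatchings es U
    sumMatchings-covered []       []       good r∈U =
      trans (k-good good) (trans (cong c r∈U) (sym (*-identityʳ _)))
    sumMatchings-covered (e ∷ es) (p ∷ ps) {U} good r∈U with meets U e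
    ... | true  = trans (+-identityʳ _)
                   (trans (sumMatchings-covered es ps good r∈U) (cong (c true *_) (sym (+-identityʳ _))))
    ... | false = trans (cong₂ _+_ (sumMatchings-covered es ps good r∈U)
                                   (sumMatchings-covered es ps (p good) (cong (_∨ _) r∈U)))
                        (sym (*-distribˡ-+ (c true) _ _))

    -- Split s m m′ says s = c true · (m − m′) + c false · m′, written without subtraction.
    Split : ℕ → ℕ → ℕ → Set
    Split s m m′ = s + c true * m′ ≡ c true * m + c false * m′

    split-+ : ∀ {s m m′ t l l′} → Split s m m′ → Split t l l′ → Split (s + t) (m + l) (m′ + l′)
    split-+ {s} {m} {m′} {t} {l} {l′} split₁ split₂ = begin
      (s + t) + c true * (m′ + l′)                        ≡⟨ regroup s t (c true) m′ l′ ⟩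
      (s + c true * m′) + (t + c true * l′)               ≡⟨ cong₂ _+_ split₁ split₂ ⟩
      (c true * m + c false * m′) + (c true * l + c false * l′) ≡⟨ collect (c true) (c false) m m′ l l′ ⟩
      c true * (m + l) + c false * (m′ + l′) ∎
      where
      open ≡-Reasoning
      regroup : ∀ s t a m′ l′ → (s + t) + a * (m′ + l′) ≡ (s + a * m′) + (t + a * l′)
      regroup = solve-∀
      collect : ∀ a b m m′ l l′ → (a * m + b * m′) + (a * l + b * l′) ≡ a * (m + l) + b * (m′ + l′)
      collect = solve-∀

    split-covered : ∀ {s m} → s ≡ c true * m → Split s m 0
    split-covered {m = m} refl = cong (c true * m +_) (trans (*-zeroʳ (c true)) (sym (*-zeroʳ (c false))))

    -- nMatchings es U − nMatchings es (insert r U) counts the matchings that cover r.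
    sumMatchings-uncovered : (es : List (Edge n)) → All Preserves es → ∀ {U} → Good U → U r ≡ false →
      Split (sumMatchings es U k) (nMatchings es U) (nMatchings es (insert r U))
    sumMatchings-uncovered []       []       good r∉U rewrite k-good good | r∉U =
      trans (+-comm (c false) _) (cong (c true * 1 +_) (sym (*-identityʳ (c false))))
    sumMatchings-uncovered (e ∷ es) (p ∷ ps) {U} good r∉U =
      split-+ (sumMatchings-uncovered es ps good r∉U) extension
      where
      extension : Split (if meets U e then 0 else sumMatchings es (addEnds U e) k)
                        (if meets U e then 0 else nMatchings es (addEnds U e))
                        (if meets (insert r U) e then 0 else nMatchings es (addEnds (insert r U) e))
      extension with meets U e in e-meets | meets (insert r U) e in e-meets′
      ... | true  | true  = split-covered (sym (*-zeroʳ (c true)))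
      ... | true  | false = contradiction (trans (sym (meets-insert r U e e-meets)) e-meets′) λ ()
      ... | false | true  = split-covered (sumMatchings-covered es ps (p good)
          (trans (addEnds-at-root r U e e-meets) (trans (cong (U r ∨_) e-meets′) (Bool.∨-zeroʳ (U r)))))
      ... | false | false = subst (Split _ _) (nMatchings-cong es (insert-addEnds r U e))
          (sumMatchings-uncovered es ps (p good)
            (trans (addEnds-at-root r U e e-meets)
              (trans (cong (U r ∨_) e-meets′) (trans (Bool.∨-identityʳ (U r)) r∉U))))

  Z⁺ Z⁻ : Rooted → ℕ
  Z⁺ H = Z (underlying H)
  Z⁻ H = Z (deleteRoot H)

  Z⁺≡nMatchings : (H : Rooted) → Z⁺ H ≡ nMatchings (RE H) ∅
  Z⁺≡nMatchings H = Z≡nMatchings (underlying H)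

  Z⁻≡nMatchings : (H : Rooted) → Z⁻ H ≡ nMatchings (RE H) (true ∷ᵛ ∅)
  Z⁻≡nMatchings H = trans (Z≡nMatchings (deleteRoot H)) (nMatchings-deleteRoot (RE H) ∅)

  Z⁺-positive : (H : Rooted) → 1 ≤ Z⁺ H
  Z⁺-positive H = subst (1 ≤_) (sym (Z⁺≡nMatchings H)) (nMatchings-positive (RE H) ∅)

  Z⁻-positive : (H : Rooted) → 1 ≤ Z⁻ H
  Z⁻-positive H = subst (1 ≤_) (sym (Z⁻≡nMatchings H)) (nMatchings-positive (RE H) _)

  module _ {p : ℕ} where

    spokes : List (Fin p) → List (Edge (suc p))
    spokes = map (λ i → zero , suc i)

    nMatchings-spokes-covered : (is : List (Fin p)) {U : VSet (suc p)} → U zero ≡ true →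
      nMatchings (spokes is) U ≡ 1
    nMatchings-spokes-covered is {U} centre∈U =
      sumMatchings-meeting (spokes is) _ (map⁺ (All.universal (λ i → cong (_∨ U (suc i)) centre∈U) is))

    nMatchings-spokes-free : (is : List (Fin p)) {U : VSet (suc p)} →
      U zero ≡ false → (∀ i → U (suc i) ≡ false) → nMatchings (spokes is) U ≡ suc (length is)
    nMatchings-spokes-free []       centre∉U leaves∉U = refl
    nMatchings-spokes-free (i ∷ is) {U} centre∉U leaves∉U rewrite centre∉U | leaves∉U i =
      trans (cong₂ _+_ (nMatchings-spokes-free is centre∉U leaves∉U)
                       (nMatchings-spokes-covered is (Bool.∨-zeroʳ (U zero))))
            (+-comm (suc (length is)) 1)

  Z⁺-star : (p : ℕ) → Z⁺ (star p) ≡ suc p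
  Z⁺-star p = trans (Z⁺≡nMatchings (star p))
    (trans (nMatchings-spokes-free (allFin p) refl (λ _ → refl)) (cong suc (length-tabulate id)))

  Z⁻-star : (p : ℕ) → Z⁻ (star p) ≡ 1
  Z⁻-star p = trans (Z⁻≡nMatchings (star p)) (nMatchings-spokes-covered (allFin p) refl)

  module _ (d : ℕ) (H : Rooted) where

    private
      bondEdge : Edge (suc (suc (k H)))
      bondEdge = zero , suc zero
      lifted : List (Edge (suc (suc (k H))))
      lifted = map (mapEdge suc) (RE H)

      lifted-free : nMatchings lifted ∅ ≡ Z⁺ H
      lifted-free = trans (nMatchings-map suc-injective (RE H) ∅) (sym (Z⁺≡nMatchings H))

      lifted-covered : nMatchings lifted (addEnds ∅ bondEdge) ≡ Z⁻ H
      lifted-covered = trans (nMatchings-map suc-injective (RE H) _)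
        (trans (nMatchings-cong (RE H) λ { zero → refl ; (suc _) → refl }) (sym (Z⁻≡nMatchings H)))

    Z⁺-bond : Z⁺ (bond d H) ≡ Z⁺ H + d * Z⁻ H
    Z⁺-bond = begin
      Z⁺ (bond d H)
        ≡⟨ Z⁺≡nMatchings (bond d H) ⟩
      nMatchings (replicate d bondEdge ++ lifted) ∅
        ≡⟨ sumMatchings-++ (replicate d bondEdge) lifted ∅ _ ⟩
      sumMatchings (replicate d bondEdge) ∅ (nMatchings lifted)
        ≡⟨ sumMatchings-parallel d bondEdge _ refl ⟩
      nMatchings lifted ∅ + d * nMatchings lifted (addEnds ∅ bondEdge)
        ≡⟨ cong₂ (λ x y → x + d * y) lifted-free lifted-covered ⟩
      Z⁺ H + d * Z⁻ H ∎
      where open ≡-Reasoning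

    Z⁻-bond : Z⁻ (bond d H) ≡ Z⁺ H
    Z⁻-bond = begin
      Z⁻ (bond d H)
        ≡⟨ Z⁻≡nMatchings (bond d H) ⟩
      nMatchings (replicate d bondEdge ++ lifted) (true ∷ᵛ ∅)
        ≡⟨ sumMatchings-++ (replicate d bondEdge) lifted _ _ ⟩
      sumMatchings (replicate d bondEdge) (true ∷ᵛ ∅) (nMatchings lifted)
        ≡⟨ sumMatchings-meeting (replicate d bondEdge) _ (replicate⁺ d refl) ⟩
      nMatchings lifted (true ∷ᵛ ∅)
        ≡⟨ nMatchings-map suc-injective (RE H) _ ⟩
      nMatchings (RE H) ∅
        ≡⟨ sym (Z⁺≡nMatchings H) ⟩
      Z⁺ H ∎
      where open ≡-Reasoning

  ↑ˡ≢↑ʳ : {m l : ℕ} (i : Fin m) (j : Fin l) → i ↑ˡ l ≢ m ↑ʳ j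
  ↑ˡ≢↑ʳ {m} {l} i j eq =
    contradiction (trans (sym (splitAt-↑ˡ m i l)) (trans (cong (splitAt m) eq) (splitAt-↑ʳ m l j))) λ ()

  module _ (G H : Rooted) where

    private
      N : ℕ
      N = suc (k G + k H)

      ιG : Fin (suc (k G)) → Fin N
      ιG i = i ↑ˡ k H

      ιH : Fin (suc (k H)) → Fin N
      ιH zero    = zero
      ιH (suc j) = suc (k G) ↑ʳ j

      ιG-injective : Injective _≡_ _≡_ ιG
      ιG-injective {i} {j} = ↑ˡ-injective (k H) i j

      ιH-injective : Injective _≡_ _≡_ ιH
      ιH-injective {zero}  {zero}  _  = refl
      ιH-injective {suc i} {suc j} eq = cong suc (↑ʳ-injective (suc (k G)) i j eq)

      esG : List (Edge N)
      esG = map (mapEdge ιG) (RE G)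

      esH : List (Edge N)
      esH = map (mapEdge ιH) (RE H)

      RE-wedge : RE (wedge G H) ≡ esG ++ esH
      RE-wedge = cong₂ _++_
        (map-cong (λ { (zero , zero) → refl ; (zero , suc _) → refl
                     ; (suc _ , zero) → refl ; (suc _ , suc _) → refl }) (RE G))
        (map-cong (λ { (zero , zero) → refl ; (zero , suc _) → refl
                     ; (suc _ , zero) → refl ; (suc _ , suc _) → refl }) (RE H))

      OffH : VSet N → Set
      OffH U = ∀ j → U (ιH (suc j)) ≡ false

      countH : Bool → ℕ
      countH β = nMatchings (RE H) (β ∷ᵛ ∅)

      countH-off : ∀ {U} → OffH U → nMatchings esH U ≡ countH (U zero)
      countH-off {U} off = trans (nMatchings-map ιH-injective (RE H) U)
                                 (nMatchings-cong (RE H) λ { zero → refl ; (suc j) → off j })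

      -- A matching of the wedge is one of G followed by one of H, and by countH-off the number
      -- of the latter only depends on whether the former covers the common root.
      open ByRoot zero OffH (nMatchings esH) countH countH-off

      preserves : All Preserves esG
      preserves = map⁺ (All.universal (λ { (x , y) off j → ∨-≡false (off j)
        (∨-≡false (≢⇒≡ᵇ-false (↑ˡ≢↑ʳ x j)) (≢⇒≡ᵇ-false (↑ˡ≢↑ʳ y j))) }) (RE G))

      nMatchings-esG : (U : VSet (suc (k G))) {W : VSet N} → W ∘ ιG ≗ U →
        nMatchings esG W ≡ nMatchings (RE G) U
      nMatchings-esG U W≗U = trans (nMatchings-map ιG-injective (RE G) _) (nMatchings-cong (RE G) W≗U)

      esG-free : nMatchings esG ∅ ≡ Z⁺ G
      esG-free = trans (nMatchings-esG ∅ λ _ → refl) (sym (Z⁺≡nMatchings G))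

      esG-covered : {W : VSet N} → W ∘ ιG ≗ true ∷ᵛ ∅ → nMatchings esG W ≡ Z⁻ G
      esG-covered W≗root = trans (nMatchings-esG _ W≗root) (sym (Z⁻≡nMatchings G))

      countH-true : countH true ≡ Z⁻ H
      countH-true = sym (Z⁻≡nMatchings H)

      countH-false : countH false ≡ Z⁺ H
      countH-false = trans (nMatchings-cong (RE H) λ { zero → refl ; (suc _) → refl }) (sym (Z⁺≡nMatchings H))

      nMatchings-wedge : (W : VSet N) → nMatchings (RE (wedge G H)) W ≡ sumMatchings esG W (nMatchings esH)
      nMatchings-wedge W = trans (cong (λ es → nMatchings es W) RE-wedge) (sumMatchings-++ esG esH W _)

    Z⁻-wedge : Z⁻ (wedge G H) ≡ Z⁻ G * Z⁻ H
    Z⁻-wedge = begin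
      Z⁻ (wedge G H)                                ≡⟨ Z⁻≡nMatchings (wedge G H) ⟩
      nMatchings (RE (wedge G H)) (true ∷ᵛ ∅)       ≡⟨ nMatchings-wedge (true ∷ᵛ ∅) ⟩
      sumMatchings esG (true ∷ᵛ ∅) (nMatchings esH) ≡⟨ sumMatchings-covered esG preserves (λ _ → refl) refl ⟩
      countH true * nMatchings esG (true ∷ᵛ ∅)     ≡⟨ cong₂ _*_ countH-true (esG-covered root-only) ⟩
      Z⁻ H * Z⁻ G                                   ≡⟨ *-comm (Z⁻ H) (Z⁻ G) ⟩
      Z⁻ G * Z⁻ H ∎
      where
      open ≡-Reasoning
      root-only : (true ∷ᵛ ∅) ∘ ιG ≗ true ∷ᵛ ∅
      root-only zero    = refl
      root-only (suc _) = refl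

    Z⁺-wedge : Z⁺ (wedge G H) + Z⁻ G * Z⁻ H ≡ Z⁺ G * Z⁻ H + Z⁻ G * Z⁺ H
    Z⁺-wedge = begin
      Z⁺ (wedge G H) + Z⁻ G * Z⁻ H
        ≡⟨ cong₂ _+_ (trans (Z⁺≡nMatchings (wedge G H)) (nMatchings-wedge ∅)) (*-comm (Z⁻ G) (Z⁻ H)) ⟩
      S + Z⁻ H * Z⁻ G
        ≡⟨ cong (S +_) (sym (cong₂ _*_ countH-true (esG-covered root-added))) ⟩
      S + countH true * nMatchings esG (insert zero ∅)
        ≡⟨ sumMatchings-uncovered esG preserves (λ _ → refl) refl ⟩
      countH true * nMatchings esG ∅ + countH false * nMatchings esG (insert zero ∅)
        ≡⟨ cong₂ _+_ (cong₂ _*_ countH-true esG-free) (cong₂ _*_ countH-false (esG-covered root-added)) ⟩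
      Z⁻ H * Z⁺ G + Z⁺ H * Z⁻ G
        ≡⟨ cong₂ _+_ (*-comm (Z⁻ H) (Z⁺ G)) (*-comm (Z⁺ H) (Z⁻ G)) ⟩
      Z⁺ G * Z⁻ H + Z⁻ G * Z⁺ H ∎
      where
      open ≡-Reasoning
      S : ℕ
      S = sumMatchings esG ∅ (nMatchings esH)
      root-added : insert zero ∅ ∘ ιG ≗ true ∷ᵛ ∅
      root-added zero    = refl
      root-added (suc _) = refl

open import Defs
open import Data.Nat using (ℕ; _≤_; _∸_; _^_)
open import Data.Vec using (Vec; map)
open import Data.Vec.Relation.Unary.All using (All)
open import Data.Rational using (_+_; _*_)
open import Relation.Binary.PropositionalEquality using (_≡_)

import Data.Nat as ℕ
open import Data.Nat using (zero; suc)
import Data.Integer as ℤ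
open import Data.Integer using (+_)
import Data.Integer.Properties as ℤ
open import Data.Nat.Coprimality using (1-coprimeTo) renaming (sym to coprime-sym)
open import Data.Rational using (ℚ; mkℚ; 0ℚ; 1ℚ; _-_; 1/_; NonZero; ≢-nonZero)
import Data.Rational.Properties as ℚ
open import Data.Vec using ([]; _∷_)
open import Data.Vec.Relation.Unary.All using ([]; _∷_)
open import Relation.Nullary using (yes; no; contradiction)
open import Relation.Nullary.Decidable using (dec⇒maybe)
open import Relation.Binary.PropositionalEquality
  using (_≢_; refl; sym; trans; cong; cong₂; subst; module ≡-Reasoning)
open import Algebra.Properties.Group ℚ.+-0-group using () renaming (∙-cancelʳ to +-cancelʳ)
import Tactic.RingSolver.Core.AlmostCommutativeRing as ACR
open import Tactic.RingSolver using (solve-∀)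
open Matchings
  using (Z⁺; Z⁻; Z⁺-positive; Z⁻-positive; Z⁺-star; Z⁻-star; Z⁺-bond; Z⁻-bond; Z⁺-wedge; Z⁻-wedge)

ℚ-ring : ACR.AlmostCommutativeRing _ _
ℚ-ring = ACR.fromCommutativeRing ℚ.+-*-commutativeRing (λ q → dec⇒maybe (0ℚ ℚ.≟ q))

ℕ→ℚ≡mkℚ : ∀ n → ℕ→ℚ n ≡ mkℚ (+ n) 0 (coprime-sym (1-coprimeTo n))
ℕ→ℚ≡mkℚ n = ℚ.normalize-coprime (coprime-sym (1-coprimeTo n))

ℕ→ℚ-homo-+ : ∀ m n → ℕ→ℚ (m ℕ.+ n) ≡ ℕ→ℚ m + ℕ→ℚ n
ℕ→ℚ-homo-+ m n = sym (trans (cong₂ _+_ (ℕ→ℚ≡mkℚ m) (ℕ→ℚ≡mkℚ n))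
  (ℚ./-cong (trans (cong₂ ℤ._+_ (ℤ.*-identityʳ (+ m)) (ℤ.*-identityʳ (+ n))) (sym (ℤ.pos-+ m n))) refl))

ℕ→ℚ-homo-* : ∀ m n → ℕ→ℚ (m ℕ.* n) ≡ ℕ→ℚ m * ℕ→ℚ n
ℕ→ℚ-homo-* m n =
  sym (trans (cong₂ _*_ (ℕ→ℚ≡mkℚ m) (ℕ→ℚ≡mkℚ n)) (ℚ./-cong (sym (ℤ.pos-* m n)) refl))

ℕ→ℚ-homo-+* : ∀ a b c → ℕ→ℚ (a ℕ.+ b ℕ.* c) ≡ ℕ→ℚ a + ℕ→ℚ b * ℕ→ℚ c
ℕ→ℚ-homo-+* a b c = trans (ℕ→ℚ-homo-+ a (b ℕ.* c)) (cong (_+_ (ℕ→ℚ a)) (ℕ→ℚ-homo-* b c))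

ℕ→ℚ-nonZero : ∀ {n} → 1 ≤ n → ℕ→ℚ n ≢ 0ℚ
ℕ→ℚ-nonZero {suc n} _ eq with () ← trans (sym (ℕ→ℚ≡mkℚ (suc n))) eq

*-÷′-cancel : ∀ p {q} → q ≢ 0ℚ → q * (p ÷′ q) ≡ p
*-÷′-cancel p {q} q≢0 with q ℚ.≟ 0ℚ
... | yes q≡0  = contradiction q≡0 q≢0
... | no  q≢0′ = begin
  q * (p * 1/q)   ≡⟨ swap q p 1/q ⟩
  p * (q * 1/q)   ≡⟨ cong (p *_) (ℚ.*-inverseʳ q) ⟩
  p * 1ℚ          ≡⟨ ℚ.*-identityʳ p ⟩
  p ∎
  where
  open ≡-Reasoning
  instance
    q-nonZero : NonZero q
    q-nonZero = ≢-nonZero q≢0′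
  1/q : ℚ
  1/q = 1/ q
  swap : ∀ x y z → x * (y * z) ≡ y * (x * z)
  swap = solve-∀ ℚ-ring

record Excess (H : Rooted) (e : ℚ) : Set where
  constructor excess
  field
    Z⁺≡Z⁻*[1+e] : ℕ→ℚ (Z⁺ H) ≡ ℕ→ℚ (Z⁻ H) * (1ℚ + e)

excess-ratio : (H : Rooted) → Excess H (ℕ→ℚ (Z⁺ H) ÷′ ℕ→ℚ (Z⁻ H) - 1ℚ)
excess-ratio H = excess (begin
  ℕ→ℚ (Z⁺ H)                    ≡⟨ sym (*-÷′-cancel (ℕ→ℚ (Z⁺ H)) Z⁻≢0) ⟩
  ℕ→ℚ (Z⁻ H) * A                ≡⟨ cong (ℕ→ℚ (Z⁻ H) *_) (one-plus-pred A) ⟩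
  ℕ→ℚ (Z⁻ H) * (1ℚ + (A - 1ℚ)) ∎)
  where
  open ≡-Reasoning
  A : ℚ
  A = ℕ→ℚ (Z⁺ H) ÷′ ℕ→ℚ (Z⁻ H)
  Z⁻≢0 : ℕ→ℚ (Z⁻ H) ≢ 0ℚ
  Z⁻≢0 = ℕ→ℚ-nonZero (Z⁻-positive H)
  one-plus-pred : ∀ x → x ≡ 1ℚ + (x - 1ℚ)
  one-plus-pred = solve-∀ ℚ-ring

excess-single : Excess single 0ℚ
excess-single = excess refl

excess-star : (p : ℕ) → Excess (star p) (ℕ→ℚ p)
excess-star p = excess (begin
  ℕ→ℚ (Z⁺ (star p))                 ≡⟨ cong ℕ→ℚ (Z⁺-star p) ⟩
  ℕ→ℚ (suc p)                       ≡⟨ ℕ→ℚ-homo-+ 1 p ⟩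
  1ℚ + ℕ→ℚ p                        ≡⟨ sym (ℚ.*-identityˡ _) ⟩
  1ℚ * (1ℚ + ℕ→ℚ p)                 ≡⟨ cong (λ z → ℕ→ℚ z * (1ℚ + ℕ→ℚ p)) (sym (Z⁻-star p)) ⟩
  ℕ→ℚ (Z⁻ (star p)) * (1ℚ + ℕ→ℚ p) ∎)
  where open ≡-Reasoning

excess-wedge : ∀ {G H e f} → Excess G e → Excess H f → Excess (wedge G H) (e + f)
excess-wedge {G} {H} {e} {f} (excess excess-G) (excess excess-H) = excess (+-cancelʳ (g⁻ * h⁻) _ _ (begin
  ℕ→ℚ (Z⁺ (wedge G H)) + g⁻ * h⁻
    ≡⟨ sym (ℕ→ℚ-homo-+* (Z⁺ (wedge G H)) (Z⁻ G) (Z⁻ H)) ⟩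
  ℕ→ℚ (Z⁺ (wedge G H) ℕ.+ Z⁻ G ℕ.* Z⁻ H)
    ≡⟨ cong ℕ→ℚ (Z⁺-wedge G H) ⟩
  ℕ→ℚ (Z⁺ G ℕ.* Z⁻ H ℕ.+ Z⁻ G ℕ.* Z⁺ H)
    ≡⟨ trans (ℕ→ℚ-homo-+* (Z⁺ G ℕ.* Z⁻ H) (Z⁻ G) (Z⁺ H))
             (cong (_+ g⁻ * ℕ→ℚ (Z⁺ H)) (ℕ→ℚ-homo-* (Z⁺ G) (Z⁻ H))) ⟩
  ℕ→ℚ (Z⁺ G) * h⁻ + g⁻ * ℕ→ℚ (Z⁺ H)
    ≡⟨ cong₂ (λ x y → x * h⁻ + g⁻ * y) excess-G excess-H ⟩
  g⁻ * (1ℚ + e) * h⁻ + g⁻ * (h⁻ * (1ℚ + f))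
    ≡⟨ regroup g⁻ h⁻ e f ⟩
  g⁻ * h⁻ * (1ℚ + (e + f)) + g⁻ * h⁻
    ≡⟨ cong (λ z → z * (1ℚ + (e + f)) + g⁻ * h⁻)
            (sym (trans (cong ℕ→ℚ (Z⁻-wedge G H)) (ℕ→ℚ-homo-* (Z⁻ G) (Z⁻ H)))) ⟩
  ℕ→ℚ (Z⁻ (wedge G H)) * (1ℚ + (e + f)) + g⁻ * h⁻ ∎))
  where
  open ≡-Reasoning
  g⁻ h⁻ : ℚ
  g⁻ = ℕ→ℚ (Z⁻ G)
  h⁻ = ℕ→ℚ (Z⁻ H)
  regroup : ∀ g h e f → g * (1ℚ + e) * h + g * (h * (1ℚ + f)) ≡ g * h * (1ℚ + (e + f)) + g * h
  regroup = solve-∀ ℚ-ring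

excess-bond : ∀ {H e} (d : ℕ) → Excess H e → Excess (bond d H) (ℕ→ℚ d ÷′ (1ℚ + e))
excess-bond {H} {e} d (excess excess-H) = excess (begin
  ℕ→ℚ (Z⁺ (bond d H))             ≡⟨ cong ℕ→ℚ (Z⁺-bond d H) ⟩
  ℕ→ℚ (Z⁺ H ℕ.+ d ℕ.* Z⁻ H)       ≡⟨ ℕ→ℚ-homo-+* (Z⁺ H) d (Z⁻ H) ⟩
  h⁺ + D * h⁻                     ≡⟨ cong (λ z → h⁺ + z * h⁻) (sym (*-÷′-cancel D 1+e≢0)) ⟩
  h⁺ + (1ℚ + e) * q * h⁻          ≡⟨ cong (_+_ h⁺) (rotate (1ℚ + e) q h⁻) ⟩
  h⁺ + h⁻ * (1ℚ + e) * q          ≡⟨ cong (λ z → h⁺ + z * q) (sym excess-H) ⟩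
  h⁺ + h⁺ * q                     ≡⟨ absorb h⁺ q ⟩
  h⁺ * (1ℚ + q)                   ≡⟨ cong (λ z → ℕ→ℚ z * (1ℚ + q)) (sym (Z⁻-bond d H)) ⟩
  ℕ→ℚ (Z⁻ (bond d H)) * (1ℚ + q) ∎)
  where
  open ≡-Reasoning
  h⁺ h⁻ D q : ℚ
  h⁺ = ℕ→ℚ (Z⁺ H)
  h⁻ = ℕ→ℚ (Z⁻ H)
  D  = ℕ→ℚ d
  q  = D ÷′ (1ℚ + e)
  1+e≢0 : 1ℚ + e ≢ 0ℚ
  1+e≢0 1+e≡0 =
    ℕ→ℚ-nonZero (Z⁺-positive H) (trans excess-H (trans (cong (h⁻ *_) 1+e≡0) (ℚ.*-zeroʳ h⁻)))
  rotate : ∀ x y z → x * y * z ≡ z * x * y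
  rotate = solve-∀ ℚ-ring
  absorb : ∀ x y → x + x * y ≡ x * (1ℚ + y)
  absorb = solve-∀ ℚ-ring

Z⁻-wedgePow : (R : Rooted) (m : ℕ) → Z⁻ (wedgePow m R) ≡ Z⁻ R ^ m
Z⁻-wedgePow R zero    = refl
Z⁻-wedgePow R (suc m) = trans (Z⁻-wedge R (wedgePow m R)) (cong (Z⁻ R ℕ.*_) (Z⁻-wedgePow R m))

excess-wedgePow : ∀ {R e} → Excess R e → (m : ℕ) → Excess (wedgePow m R) (ℕ→ℚ m * e)
excess-wedgePow {e = e} excess-R zero    = subst (Excess single) (sym (ℚ.*-zeroˡ e)) excess-single
excess-wedgePow {e = e} excess-R (suc m) =
  subst (Excess _) (sym (trans (cong (_* e) (ℕ→ℚ-homo-+ 1 m)) (unfold (ℕ→ℚ m) e)))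
        (excess-wedge excess-R (excess-wedgePow excess-R m))
  where
  unfold : ∀ x y → (1ℚ + x) * y ≡ y + x * y
  unfold = solve-∀ ℚ-ring

excess-chain : ∀ {n} (bs : Vec ℕ n) (pbs : All (1 ≤_) bs) (Hs : Vec CTree n) →
  Excess (chainGraph (radialChain bs pbs Hs)) (contFrac bs (map ratioA Hs))
excess-chain []       []        []       = excess-single
excess-chain (b ∷ bs) (_ ∷ pbs) (H ∷ Hs) =
  subst (Excess _) (cong (ℕ→ℚ b ÷′_) (cancel-pred (ratioA H) (contFrac bs (map ratioA Hs))))
        (excess-bond b (excess-wedge (excess-ratio (treeGraph H)) (excess-chain bs pbs Hs)))
  where
  cancel-pred : ∀ x y → 1ℚ + ((x - 1ℚ) + y) ≡ x + y
  cancel-pred = solve-∀ ℚ-ring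

excess-radial : ∀ {n} (a₀ : ℕ) (bs : Vec ℕ n) (pbs : All (1 ≤_) bs) (Hs : Vec CTree n) →
  Excess (radial a₀ bs pbs Hs) (ℕ→ℚ (a₀ ∸ 1) + contFrac bs (map ratioA Hs))
excess-radial a₀ bs pbs Hs = excess-wedge (excess-star (a₀ ∸ 1)) (excess-chain bs pbs Hs)

theorem2 : (m n a₀ : ℕ) → 1 ≤ m → 1 ≤ n → 1 ≤ a₀ →
    (bs : Vec ℕ n) → (pbs : All (1 ≤_) bs) → (Hs : Vec CTree n) →
    ℕ→ℚ (Z (underlying (wedgePow m (radial a₀ bs pbs Hs))))
      ≡ ℕ→ℚ (Z (deleteRoot (radial a₀ bs pbs Hs)) ^ m)
        * (ℕ→ℚ (m Data.Nat.* (a₀ ∸ 1) Data.Nat.+ 1)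
           + ℕ→ℚ m * contFrac bs (map ratioA Hs))
theorem2 m n a₀ _ _ _ bs pbs Hs = begin
  ℕ→ℚ (Z⁺ (wedgePow m R))
    ≡⟨ Excess.Z⁺≡Z⁻*[1+e] (excess-wedgePow (excess-radial a₀ bs pbs Hs) m) ⟩
  ℕ→ℚ (Z⁻ (wedgePow m R)) * (1ℚ + M * (α + cf))
    ≡⟨ cong₂ _*_ (cong ℕ→ℚ (Z⁻-wedgePow R m))
                 (trans (regroup M α cf) (cong (_+ M * cf) (sym root-term))) ⟩
  ℕ→ℚ (Z⁻ R ^ m) * (ℕ→ℚ (m ℕ.* (a₀ ∸ 1) ℕ.+ 1) + M * cf) ∎
  where
  open ≡-Reasoning
  R : Rooted
  R = radial a₀ bs pbs Hs
  M α cf : ℚ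
  M  = ℕ→ℚ m
  α  = ℕ→ℚ (a₀ ∸ 1)
  cf = contFrac bs (map ratioA Hs)
  root-term : ℕ→ℚ (m ℕ.* (a₀ ∸ 1) ℕ.+ 1) ≡ M * α + 1ℚ
  root-term = trans (ℕ→ℚ-homo-+ (m ℕ.* (a₀ ∸ 1)) 1) (cong (_+ 1ℚ) (ℕ→ℚ-homo-* m (a₀ ∸ 1)))
  regroup : ∀ x y z → 1ℚ + x * (y + z) ≡ (x * y + 1ℚ) + x * z
  regroup = solve-∀ ℚ-ring
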